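{- Let $r_1\ge 2$ and $x_1\ge 1$ be integers, set $d=x_1+r_1-1$, let $\mathbf{q}=(r_1^{x_1},(1+r_1x_1)^{r_1-1})\in\mathbb{Z}^d$ and $\Delta_{(1,\mathbf{q})}=\operatorname{conv}\{\mathbf{e}_1,\ldots,\mathbf{e}_d,-\mathbf{q}\}\subset\mathbb{R}^d$. For $\mathbf{t}=(t_1,\ldots,t_d)\in\mathbb{R}^d$ define $\lambda_k(\mathbf{t})=\sum_{j\ne k}t_j-x_1r_1t_k$ for $1\le k\le x_1$; $\lambda_k(\mathbf{t})=\sum_{j\ne k}t_j-(r_1-1)t_k$ for $x_1+1\le k\le d$; and $\lambda_{d+1}(\mathbf{t})=\sum_{j=1}^d t_j$ (sums over $j\in\{1,\ldots,d\}$). Then the inequalities $\lambda_k(\mathbf{t})\le 1$, $1\le k\le d+1$, form an irredundant $\mathcal{H}$-description of $\Delta_{(1,\mathbf{q})}$.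
   Context: $\mathbf{e}_i$ denotes the $i$-th standard basis vector of $\mathbb{R}^d$; $(r^{x},s^{y})$ denotes $x$ copies of $r$ followed by $y$ copies of $s$.
   Formalization: The points $\mathbf{t}$ have rational coordinates and the convex-combination weights defining $\Delta_{(1,\mathbf{q})}$ are rational, with ℚ^d in place of $\mathbb{R}^d$. -}

module Defs where

open import Data.Nat as ℕ using (ℕ; zero; suc; _∸_; _<?_)
open import Data.Fin using (Fin; zero; suc; toℕ)
open import Data.Integer using (+_)
open import Data.Rational using (ℚ; 0ℚ; 1ℚ; _+_; _*_; -_; _≤_; _<_; _/_)
open import Data.Bool using (if_then_else_)
open import Data.Product using (Σ; ∃; _×_)
open import Relation.Nullary using (¬_)
open import Relation.Nullary.Decidable using (⌊_⌋)
open import Relation.Binary.PropositionalEquality using (_≡_)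
open import Function.Bundles using (_⇔_)

ℕtoℚ : ℕ → ℚ
ℕtoℚ n = + n / 1

Point : ℕ → Set
Point d = Fin d → ℚ

∑ : {n : ℕ} → (Fin n → ℚ) → ℚ
∑ {zero}  f = 0ℚ
∑ {suc n} f = f zero + ∑ (λ i → f (suc i))

InConvexHull : {n d : ℕ} → (Fin n → Point d) → Point d → Set
InConvexHull {n} {d} v t =
  Σ (Fin n → ℚ) λ μ →
    (∀ i → 0ℚ ≤ μ i) × (∑ μ ≡ 1ℚ) × (∀ c → t c ≡ ∑ (λ i → μ i * v i c))

dot : {d : ℕ} → Point d → Point d → ℚ
dot a t = ∑ (λ j → a j * t j)

IsHDescription : {m d : ℕ} → (Fin m → Point d) → (Fin m → ℚ) → (Point d → Set) → Set
IsHDescription {m} {d} a b P = ∀ (t : Point d) → P t ⇔ (∀ k → dot (a k) t ≤ b k)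

IsIrredundant : {m d : ℕ} → (Fin m → Point d) → (Fin m → ℚ) → Set
IsIrredundant {m} {d} a b =
  ∀ (k : Fin m) → ∃ λ (t : Point d) →
    (∀ j → ¬ (j ≡ k) → dot (a j) t ≤ b j) × (b k < dot (a k) t)

IsIrredundantHDescription : {m d : ℕ} → (Fin m → Point d) → (Fin m → ℚ) → (Point d → Set) → Set
IsIrredundantHDescription a b P = IsHDescription a b P × IsIrredundant a b

-- the specific data; d = x₁ + r₁ - 1, coordinates indexed 0..d-1
-- (paper index k corresponds to Fin index k-1)
dim : ℕ → ℕ → ℕ
dim r₁ x₁ = x₁ ℕ.+ r₁ ∸ 1

qvec : (r₁ x₁ : ℕ) → Point (dim r₁ x₁)
qvec r₁ x₁ c = if ⌊ toℕ c <? x₁ ⌋ then ℕtoℚ r₁ else ℕtoℚ (1 ℕ.+ r₁ ℕ.* x₁)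

vertex : (r₁ x₁ : ℕ) → Fin (suc (dim r₁ x₁)) → Point (dim r₁ x₁)
vertex r₁ x₁ i c =
  if ⌊ toℕ i ℕ.≟ dim r₁ x₁ ⌋ then - qvec r₁ x₁ c
  else (if ⌊ toℕ i ℕ.≟ toℕ c ⌋ then 1ℚ else 0ℚ)

Δ : (r₁ x₁ : ℕ) → Point (dim r₁ x₁) → Set
Δ r₁ x₁ = InConvexHull (vertex r₁ x₁)

-- coefficient of t_j in λ_k.  For the last index k = d (paper's d+1)
-- toℕ k ≠ toℕ j always, so all coefficients are 1.
lamCoeff : (r₁ x₁ : ℕ) → Fin (suc (dim r₁ x₁)) → Point (dim r₁ x₁)
lamCoeff r₁ x₁ k j =
  if ⌊ toℕ k ℕ.≟ toℕ j ⌋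
  then (if ⌊ toℕ k <? x₁ ⌋ then - ℕtoℚ (x₁ ℕ.* r₁) else - ℕtoℚ (r₁ ∸ 1))
  else 1ℚ

lam : (r₁ x₁ : ℕ) → Fin (suc (dim r₁ x₁)) → Point (dim r₁ x₁) → ℚ
lam r₁ x₁ k t = dot (lamCoeff r₁ x₁ k) t

-- Δ is a d-simplex with vertices e₁, …, e_d, -q, and λ₁, …, λ_{d+1} are the affine forms of its facets:
-- λ_k equals 1 at every vertex except the k-th one (e_k, resp. -q for k = d+1), where it is < 1.
-- For k ≤ d this holds at -q because q_k (1 - a_k) = 1 + ∑ q, where a_k is the diagonal coefficient
-- of λ_k; for the paper's q both blocks give (1 + r₁x₁) r₁.  Hence the inequalities hold on Δ; conversely,
-- if they hold at t, then the barycentric coordinates (t + ρ q, ρ), ρ = (1 - ∑ t) / (1 + ∑ q), are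
-- nonnegative; and 2 v_j - v_k (j ≠ k) violates only the k-th inequality.
{-# OPTIONS --safe #-}
module Submission where

open import Defs
open import Data.Nat using (ℕ; _≤_)
open import Data.Rational using (1ℚ)

open import Algebra.Bundles using (CommutativeMonoid)
open import Data.Bool.Base using (true; false; if_then_else_)
open import Data.Fin.Base using (Fin; zero; suc; toℕ; fromℕ; fromℕ<; inject₁)
import Data.Fin.Properties as Fin
import Data.Integer.Base as ℤ
import Data.Integer.Properties as ℤ
open import Data.Nat as ℕ using (zero; suc; _∸_; s≤s; z≤n)
import Data.Nat.Properties as ℕₚ
open import Data.Nat.Tactic.RingSolver using (solve-∀)
open import Data.Product.Base using (∃; _,_; proj₁; proj₂)
open import Data.Rational.Base
  using (ℚ; 0ℚ; _+_; _*_; -_; _-_; _<_; 1/_; NonZero; Positive; toℚᵘ; positive; nonNegative)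
  renaming (_≤_ to _≤ℚ_)
open import Data.Rational.Properties
open import Algebra.Properties.CommutativeSemigroup
  (CommutativeMonoid.commutativeSemigroup *-1-commutativeMonoid) using (x∙yz≈y∙xz)
import Data.Rational.Unnormalised.Base as ℚᵘ
import Data.Rational.Unnormalised.Properties as ℚᵘ
open import Data.Rational.Solver using (module +-*-Solver)
open import Function.Base using (_∘_)
open import Function.Bundles using (mk⇔; Equivalence)
open import Relation.Binary.PropositionalEquality
open import Relation.Nullary.Decidable using (Dec; yes; no; ⌊_⌋; isYes≗does)
open import Relation.Nullary.Negation using (¬_; contradiction)

-- ℕtoℚ n normalises n / 1, so its homomorphism properties are proved in ℚᵘ, where nothing is normalised.
ℕtoℚ-homo₂ : ∀ {_∙ᴺ_ : ℕ → ℕ → ℕ} {_∙_ : ℚ → ℚ → ℚ} {_∙ᵘ_ : ℚᵘ.ℚᵘ → ℚᵘ.ℚᵘ → ℚᵘ.ℚᵘ} →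
  (∀ p q → toℚᵘ (p ∙ q) ℚᵘ.≃ toℚᵘ p ∙ᵘ toℚᵘ q) →
  (∀ {p p′ q q′} → p ℚᵘ.≃ p′ → q ℚᵘ.≃ q′ → (p ∙ᵘ q) ℚᵘ.≃ (p′ ∙ᵘ q′)) →
  (∀ m n → ℚᵘ.mkℚᵘ (ℤ.+ (m ∙ᴺ n)) 0 ℚᵘ.≃ ℚᵘ.mkℚᵘ (ℤ.+ m) 0 ∙ᵘ ℚᵘ.mkℚᵘ (ℤ.+ n) 0) →
  ∀ m n → ℕtoℚ (m ∙ᴺ n) ≡ ℕtoℚ m ∙ ℕtoℚ n
ℕtoℚ-homo₂ {_∙ᴺ_} {_∙_} {_∙ᵘ_} homo cong-∙ᵘ homoᵘ m n = toℚᵘ-injective (begin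
  toℚᵘ (ℕtoℚ (m ∙ᴺ n))                     ≈⟨ toℚᵘ-fromℚᵘ _ ⟩
  ℚᵘ.mkℚᵘ (ℤ.+ (m ∙ᴺ n)) 0                 ≈⟨ homoᵘ m n ⟩
  ℚᵘ.mkℚᵘ (ℤ.+ m) 0 ∙ᵘ ℚᵘ.mkℚᵘ (ℤ.+ n) 0   ≈⟨ cong-∙ᵘ (toℚᵘ-fromℚᵘ _) (toℚᵘ-fromℚᵘ _) ⟨
  toℚᵘ (ℕtoℚ m) ∙ᵘ toℚᵘ (ℕtoℚ n)           ≈⟨ homo (ℕtoℚ m) (ℕtoℚ n) ⟨
  toℚᵘ (ℕtoℚ m ∙ ℕtoℚ n)                   ∎)
  where open ℚᵘ.≃-Reasoning

ℕtoℚ-+ : ∀ m n → ℕtoℚ (m ℕ.+ n) ≡ ℕtoℚ m + ℕtoℚ n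
ℕtoℚ-+ = ℕtoℚ-homo₂ {ℕ._+_} toℚᵘ-homo-+ ℚᵘ.+-cong λ m n → ℚᵘ.*≡* (cong (ℤ._* ℤ.+ 1)
  (trans (ℤ.pos-+ m n) (sym (cong₂ ℤ._+_ (ℤ.*-identityʳ (ℤ.+ m)) (ℤ.*-identityʳ (ℤ.+ n))))))

ℕtoℚ-* : ∀ m n → ℕtoℚ (m ℕ.* n) ≡ ℕtoℚ m * ℕtoℚ n
ℕtoℚ-* = ℕtoℚ-homo₂ {ℕ._*_} toℚᵘ-homo-* ℚᵘ.*-cong λ m n → ℚᵘ.*≡* (cong (ℤ._* ℤ.+ 1) (ℤ.pos-* m n))

ℕtoℚ-suc : ∀ n → ℕtoℚ (suc n) ≡ 1ℚ + ℕtoℚ n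
ℕtoℚ-suc = ℕtoℚ-+ 1

ℕtoℚ-nonNeg : ∀ n → 0ℚ ≤ℚ ℕtoℚ n
ℕtoℚ-nonNeg n = nonNegative⁻¹ (ℕtoℚ n) {{normalize-nonNeg n 1}}

0≤1-p : ∀ {p} → p ≤ℚ 1ℚ → 0ℚ ≤ℚ 1ℚ - p
0≤1-p p≤1 = +-monoʳ-≤ 1ℚ (neg-antimono-≤ p≤1)

0≤* : ∀ {p q} → 0ℚ ≤ℚ p → 0ℚ ≤ℚ q → 0ℚ ≤ℚ p * q
0≤* {p} {q} 0≤p 0≤q = nonNegative⁻¹ (p * q) {{nonNeg*nonNeg⇒nonNeg p {{nonNegative 0≤p}} q {{nonNegative 0≤q}}}}

∑-cong : ∀ {n} {f g : Fin n → ℚ} → (∀ i → f i ≡ g i) → ∑ f ≡ ∑ g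
∑-cong {zero}  _   = refl
∑-cong {suc n} f≗g = cong₂ _+_ (f≗g zero) (∑-cong (f≗g ∘ suc))

∑-+ : ∀ {n} (f g : Fin n → ℚ) → ∑ (λ i → f i + g i) ≡ ∑ f + ∑ g
∑-+ {zero}  f g = sym (+-identityˡ 0ℚ)
∑-+ {suc n} f g = trans (cong ((f zero + g zero) +_) (∑-+ (f ∘ suc) (g ∘ suc)))
  (solve 4 (λ a b c d → (a :+ b) :+ (c :+ d) := (a :+ c) :+ (b :+ d)) refl (f zero) (g zero) _ _)
  where open +-*-Solver

∑-*ˡ : ∀ {n} c (f : Fin n → ℚ) → ∑ (λ i → c * f i) ≡ c * ∑ f
∑-*ˡ {zero}  c f = sym (*-zeroʳ c)
∑-*ˡ {suc n} c f = trans (cong (c * f zero +_) (∑-*ˡ c (f ∘ suc))) (sym (*-distribˡ-+ c (f zero) _))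

∑-neg : ∀ {n} (f : Fin n → ℚ) → ∑ (λ i → - f i) ≡ - ∑ f
∑-neg {zero}  f = refl
∑-neg {suc n} f = trans (cong (- f zero +_) (∑-neg (f ∘ suc))) (sym (neg-distrib-+ (f zero) _))

∑-const : ∀ n c → ∑ {n} (λ _ → c) ≡ ℕtoℚ n * c
∑-const zero    c = sym (*-zeroˡ c)
∑-const (suc n) c = begin
  c + ∑ {n} (λ _ → c)   ≡⟨ cong (c +_) (∑-const n c) ⟩
  c + ℕtoℚ n * c        ≡⟨ cong₂ _+_ (*-identityˡ c) refl ⟨
  1ℚ * c + ℕtoℚ n * c   ≡⟨ *-distribʳ-+ c 1ℚ (ℕtoℚ n) ⟨
  (1ℚ + ℕtoℚ n) * c     ≡⟨ cong (_* c) (ℕtoℚ-suc n) ⟨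
  ℕtoℚ (suc n) * c      ∎
  where open ≡-Reasoning

∑-0 : ∀ n → ∑ {n} (λ _ → 0ℚ) ≡ 0ℚ
∑-0 n = trans (∑-const n 0ℚ) (*-zeroʳ (ℕtoℚ n))

∑-swap : ∀ {m n} (f : Fin m → Fin n → ℚ) → ∑ (λ i → ∑ (f i)) ≡ ∑ (λ j → ∑ (λ i → f i j))
∑-swap {zero}  {n} f = sym (∑-0 n)
∑-swap {suc m}     f = trans (cong (∑ (f zero) +_) (∑-swap (f ∘ suc))) (sym (∑-+ (f zero) _))

∑-mono : ∀ {n} {f g : Fin n → ℚ} → (∀ i → f i ≤ℚ g i) → ∑ f ≤ℚ ∑ g
∑-mono {zero}  _   = ≤-refl
∑-mono {suc n} f≤g = +-mono-≤ (f≤g zero) (∑-mono (f≤g ∘ suc))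

∑-nonNeg : ∀ {n} {f : Fin n → ℚ} → (∀ i → 0ℚ ≤ℚ f i) → 0ℚ ≤ℚ ∑ f
∑-nonNeg {n} {f} 0≤f = subst (_≤ℚ ∑ f) (∑-0 n) (∑-mono 0≤f)

∑-init-last : ∀ {n} (f : Fin (suc n) → ℚ) → ∑ f ≡ ∑ (f ∘ inject₁) + f (fromℕ n)
∑-init-last {zero}  f = +-comm (f zero) 0ℚ
∑-init-last {suc n} f = trans (cong (f zero +_) (∑-init-last (f ∘ suc))) (sym (+-assoc (f zero) _ _))

∑-single : ∀ {n} {f : Fin n → ℚ} k → (∀ j → j ≢ k → f j ≡ 0ℚ) → ∑ f ≡ f k
∑-single {suc n} {f} zero f≡0 = begin
  f zero + ∑ (f ∘ suc)          ≡⟨ cong (f zero +_) (∑-cong λ j → f≡0 (suc j) λ ()) ⟩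
  f zero + ∑ {n} (λ _ → 0ℚ)     ≡⟨ cong (f zero +_) (∑-0 n) ⟩
  f zero + 0ℚ                   ≡⟨ +-identityʳ (f zero) ⟩
  f zero                        ∎
  where open ≡-Reasoning
∑-single {suc n} {f} (suc k) f≡0 = begin
  f zero + ∑ (f ∘ suc)   ≡⟨ cong₂ _+_ (f≡0 zero λ ()) (∑-single k λ j j≢k → f≡0 (suc j) (j≢k ∘ Fin.suc-injective)) ⟩
  0ℚ + f (suc k)         ≡⟨ +-identityˡ (f (suc k)) ⟩
  f (suc k)              ∎
  where open ≡-Reasoning

-- Not definitional, although the two does fields are.
<?-suc : ∀ m n → ⌊ suc m ℕ.<? suc n ⌋ ≡ ⌊ m ℕ.<? n ⌋
<?-suc m n = trans (isYes≗does (suc m ℕ.<? suc n)) (sym (isYes≗does (m ℕ.<? n)))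

∑-if-< : ∀ x m {A B} → ∑ {x ℕ.+ m} (λ c → if ⌊ toℕ c ℕ.<? x ⌋ then A else B) ≡ ℕtoℚ x * A + ℕtoℚ m * B
∑-if-< zero    m {A} {B} = trans (∑-const m B) (sym (trans (cong (_+ _) (*-zeroˡ A)) (+-identityˡ _)))
∑-if-< (suc x) m {A} {B} = begin
  A + ∑ {x ℕ.+ m} (λ c → if ⌊ suc (toℕ c) ℕ.<? suc x ⌋ then A else B)
    ≡⟨ cong (A +_) (∑-cong {x ℕ.+ m} λ c → cong (if_then A else B) (<?-suc (toℕ c) x)) ⟩
  A + ∑ {x ℕ.+ m} (λ c → if ⌊ toℕ c ℕ.<? x ⌋ then A else B)
    ≡⟨ cong (A +_) (∑-if-< x m) ⟩
  A + (ℕtoℚ x * A + ℕtoℚ m * B)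
    ≡⟨ solve 4 (λ A B X M → A :+ (X :* A :+ M :* B) := (con 1ℚ :+ X) :* A :+ M :* B) refl A B (ℕtoℚ x) (ℕtoℚ m) ⟩
  (1ℚ + ℕtoℚ x) * A + ℕtoℚ m * B
    ≡⟨ cong (λ y → y * A + ℕtoℚ m * B) (ℕtoℚ-suc x) ⟨
  ℕtoℚ (suc x) * A + ℕtoℚ m * B
    ∎
  where open ≡-Reasoning
        open +-*-Solver

dot-+ : ∀ {d} (a u w : Point d) → dot a (λ c → u c + w c) ≡ dot a u + dot a w
dot-+ a u w = trans (∑-cong λ j → *-distribˡ-+ (a j) (u j) (w j)) (∑-+ (λ j → a j * u j) (λ j → a j * w j))

dot-neg : ∀ {d} (a u : Point d) → dot a (λ c → - u c) ≡ - dot a u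
dot-neg a u = trans (∑-cong λ j → sym (neg-distribʳ-* (a j) (u j))) (∑-neg (λ j → a j * u j))

dot-convexCombination : ∀ {n d} (a : Point d) (v : Fin n → Point d) (μ : Fin n → ℚ) →
  dot a (λ c → ∑ (λ i → μ i * v i c)) ≡ ∑ (λ i → μ i * dot a (v i))
dot-convexCombination a v μ = begin
  ∑ (λ j → a j * ∑ (λ i → μ i * v i j))     ≡⟨ ∑-cong (λ j → ∑-*ˡ (a j) (λ i → μ i * v i j)) ⟨
  ∑ (λ j → ∑ (λ i → a j * (μ i * v i j)))   ≡⟨ ∑-swap (λ j i → a j * (μ i * v i j)) ⟩
  ∑ (λ i → ∑ (λ j → a j * (μ i * v i j)))   ≡⟨ ∑-cong (λ i → ∑-cong λ j → x∙yz≈y∙xz (a j) (μ i) (v i j)) ⟩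
  ∑ (λ i → ∑ (λ j → μ i * (a j * v i j)))   ≡⟨ ∑-cong (λ i → ∑-*ˡ (μ i) (λ j → a j * v i j)) ⟩
  ∑ (λ i → μ i * dot a (v i))               ∎
  where open ≡-Reasoning

InConvexHull⇒dot≤ : ∀ {n d} {v : Fin n → Point d} {t : Point d} (a : Point d) {b : ℚ} →
  (∀ i → dot a (v i) ≤ℚ b) → InConvexHull v t → dot a t ≤ℚ b
InConvexHull⇒dot≤ {v = v} {t} a {b} v≤b (μ , μ≥0 , ∑μ≡1 , t≡∑μv) = begin
  dot a t                               ≡⟨ ∑-cong (λ j → cong (a j *_) (t≡∑μv j)) ⟩
  dot a (λ c → ∑ (λ i → μ i * v i c))   ≡⟨ dot-convexCombination a v μ ⟩
  ∑ (λ i → μ i * dot a (v i))           ≤⟨ ∑-mono (λ i → *-monoˡ-≤-nonNeg (μ i) {{nonNegative (μ≥0 i)}} (v≤b i)) ⟩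
  ∑ (λ i → μ i * b)                     ≡⟨ ∑-cong (λ i → *-comm (μ i) b) ⟩
  ∑ (λ i → b * μ i)                     ≡⟨ ∑-*ˡ b μ ⟩
  b * ∑ μ                               ≡⟨ cong (b *_) ∑μ≡1 ⟩
  b * 1ℚ                                ≡⟨ *-identityʳ b ⟩
  b                                     ∎
  where open ≤-Reasoning

module FacetIncidence {n d : ℕ} (L v : Fin n → Point d)
  (incident : ∀ j i → j ≢ i → dot (L j) (v i) ≡ 1ℚ) (diagonal : ∀ i → dot (L i) (v i) < 1ℚ) where

  dot≤1 : ∀ j i → dot (L j) (v i) ≤ℚ 1ℚ
  dot≤1 j i with j Fin.≟ i
  ... | yes refl = <⇒≤ (diagonal j)
  ... | no j≢i   = ≤-reflexive (incident j i j≢i)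

  InConvexHull⇒dot≤1 : ∀ {t} → InConvexHull v t → ∀ k → dot (L k) t ≤ℚ 1ℚ
  InConvexHull⇒dot≤1 t∈conv k = InConvexHull⇒dot≤ (L k) (dot≤1 k) t∈conv

  irredundant : (∀ k → ∃ λ j → j ≢ k) → IsIrredundant L (λ _ → 1ℚ)
  irredundant other k = t , satisfied , violated
    where
    j₀ = proj₁ (other k)

    t : Point d
    t c = (v j₀ c + v j₀ c) - v k c

    dot-t : ∀ j → dot (L j) t ≡ (dot (L j) (v j₀) + dot (L j) (v j₀)) - dot (L j) (v k)
    dot-t j = trans (dot-+ (L j) _ _) (cong₂ _+_ (dot-+ (L j) _ _) (dot-neg (L j) _))

    satisfied : ∀ j → j ≢ k → dot (L j) t ≤ℚ 1ℚ
    satisfied j j≢k rewrite dot-t j | incident j k j≢k =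
      +-monoˡ-≤ (- 1ℚ) (+-mono-≤ (dot≤1 j j₀) (dot≤1 j j₀))

    violated : 1ℚ < dot (L k) t
    violated rewrite dot-t k | incident k j₀ (proj₂ (other k) ∘ sym) =
      +-monoʳ-< (1ℚ + 1ℚ) (neg-antimono-< (diagonal k))

if-yes : ∀ {A : Set} (a? : Dec A) {x y : ℚ} → A → (if ⌊ a? ⌋ then x else y) ≡ x
if-yes (yes _) _ = refl
if-yes (no ¬a) a = contradiction a ¬a

if-no : ∀ {A : Set} (a? : Dec A) {x y : ℚ} → ¬ A → (if ⌊ a? ⌋ then x else y) ≡ y
if-no (yes a) ¬a = contradiction a ¬a
if-no (no _)  _  = refl

data InitLast {n : ℕ} : Fin (suc n) → Set where
  last : InitLast (fromℕ n)
  init : (i : Fin n) → InitLast (inject₁ i)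

initLast : ∀ {n} (k : Fin (suc n)) → InitLast k
initLast {zero}  zero    = last
initLast {suc n} zero    = init zero
initLast {suc n} (suc k) with initLast k
... | last   = last
... | init i = init (suc i)

snoc : ∀ {A : Set} {n} → (Fin n → A) → A → Fin (suc n) → A
snoc {n = zero}  f z _       = z
snoc {n = suc n} f z zero    = f zero
snoc {n = suc n} f z (suc i) = snoc (f ∘ suc) z i

snoc-inject₁ : ∀ {A : Set} {n} (f : Fin n → A) z i → snoc f z (inject₁ i) ≡ f i
snoc-inject₁ {n = suc n} f z zero    = refl
snoc-inject₁ {n = suc n} f z (suc i) = snoc-inject₁ (f ∘ suc) z i

snoc-fromℕ : ∀ {A : Set} n (f : Fin n → A) z → snoc f z (fromℕ n) ≡ z
snoc-fromℕ zero    f z = refl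
snoc-fromℕ (suc n) f z = snoc-fromℕ n (f ∘ suc) z

basis : ∀ {d} → Fin d → Point d
basis i c = if ⌊ toℕ i ℕ.≟ toℕ c ⌋ then 1ℚ else 0ℚ

basis-diag : ∀ {d} (i : Fin d) → basis i i ≡ 1ℚ
basis-diag i = if-yes (toℕ i ℕ.≟ toℕ i) refl

basis-off : ∀ {d} {i j : Fin d} → i ≢ j → basis i j ≡ 0ℚ
basis-off {i = i} {j} i≢j = if-no (toℕ i ℕ.≟ toℕ j) (i≢j ∘ Fin.toℕ-injective)

dot-basis : ∀ {d} (a : Point d) i → dot a (basis i) ≡ a i
dot-basis a i = begin
  ∑ (λ j → a j * basis i j)   ≡⟨ ∑-single i (λ j j≢i → trans (cong (a j *_) (basis-off (j≢i ∘ sym))) (*-zeroʳ (a j))) ⟩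
  a i * basis i i             ≡⟨ cong (a i *_) (basis-diag i) ⟩
  a i * 1ℚ                    ≡⟨ *-identityʳ (a i) ⟩
  a i                         ∎
  where open ≡-Reasoning

-- Literally the shape of vertex, so that Δ r₁ x₁ is InConvexHull (simplexVertex (qvec r₁ x₁)) by definition.
simplexVertex : ∀ {d} → Point d → Fin (suc d) → Point d
simplexVertex {d} q i c = if ⌊ toℕ i ℕ.≟ d ⌋ then - q c else (if ⌊ toℕ i ℕ.≟ toℕ c ⌋ then 1ℚ else 0ℚ)

-- toℕ (fromℕ d) matches no column, so the last row is λ_{d+1} = ∑ t.
facetNormal : ∀ {d} → Point d → Fin (suc d) → Point d
facetNormal a k j = if ⌊ toℕ k ℕ.≟ toℕ j ⌋ then a j else 1ℚ

module _ {d : ℕ} where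

  simplexVertex-init : ∀ (q : Point d) i c → simplexVertex q (inject₁ i) c ≡ basis i c
  simplexVertex-init q i c = trans (if-no (toℕ (inject₁ i) ℕ.≟ d) (Fin.toℕ-inject₁-≢ i ∘ sym))
    (cong (λ n → if ⌊ n ℕ.≟ toℕ c ⌋ then 1ℚ else 0ℚ) (Fin.toℕ-inject₁ i))

  simplexVertex-last : ∀ (q : Point d) c → simplexVertex q (fromℕ d) c ≡ - q c
  simplexVertex-last q c = if-yes (toℕ (fromℕ d) ℕ.≟ d) (Fin.toℕ-fromℕ d)

  facetNormal-diag : ∀ (a : Point d) k → facetNormal a (inject₁ k) k ≡ a k
  facetNormal-diag a k = if-yes (toℕ (inject₁ k) ℕ.≟ toℕ k) (Fin.toℕ-inject₁ k)

  facetNormal-off : ∀ (a : Point d) {k j} → toℕ k ≢ toℕ j → facetNormal a k j ≡ 1ℚ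
  facetNormal-off a {k} {j} k≢j = if-no (toℕ k ℕ.≟ toℕ j) k≢j

  facetNormal-last : ∀ (a : Point d) j → facetNormal a (fromℕ d) j ≡ 1ℚ
  facetNormal-last a j = facetNormal-off a λ d≡j →
    ℕₚ.<-irrefl (trans (sym d≡j) (Fin.toℕ-fromℕ d)) (Fin.toℕ<n j)

module Simplex {d : ℕ} (q a : Point d) (q≥0 : ∀ k → 0ℚ ≤ℚ q k)
               (facet : ∀ k → q k * (1ℚ - a k) ≡ 1ℚ + ∑ q) where

  private
    L v : Fin (suc d) → Point d
    L = facetNormal a
    v = simplexVertex q

  P : ℚ
  P = 1ℚ + ∑ q

  0<P : 0ℚ < P
  0<P = +-mono-<-≤ (positive⁻¹ 1ℚ) (∑-nonNeg q≥0)

  instance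
    P>0 : Positive P
    P>0 = positive 0<P
    P≢0 : NonZero P
    P≢0 = pos⇒nonZero P

  0≤1/P : 0ℚ ≤ℚ 1/ P
  0≤1/P = nonNegative⁻¹ (1/ P) {{pos⇒nonNeg (1/ P) {{1/pos⇒pos P}}}}

  a<1 : ∀ k → a k < 1ℚ
  a<1 k = ≰⇒> λ 1≤a → <-irrefl refl (<-≤-trans 0<P (begin
    P                  ≡⟨ facet k ⟨
    q k * (1ℚ - a k)   ≤⟨ *-monoˡ-≤-nonNeg (q k) {{nonNegative (q≥0 k)}} (+-monoʳ-≤ 1ℚ (neg-antimono-≤ 1≤a)) ⟩
    q k * 0ℚ           ≡⟨ *-zeroʳ (q k) ⟩
    0ℚ                 ∎))
    where open ≤-Reasoning

  dot-L-init : ∀ k t → dot (L (inject₁ k)) t ≡ ∑ t + (a k - 1ℚ) * t k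
  dot-L-init k t = begin
    ∑ (λ j → L (inject₁ k) j * t j)                ≡⟨ ∑-cong (λ j → solve 2 (λ l y → l :* y := y :+ (l :- con 1ℚ) :* y) refl (L (inject₁ k) j) (t j)) ⟩
    ∑ (λ j → t j + (L (inject₁ k) j - 1ℚ) * t j)   ≡⟨ ∑-+ t (λ j → (L (inject₁ k) j - 1ℚ) * t j) ⟩
    ∑ t + ∑ (λ j → (L (inject₁ k) j - 1ℚ) * t j)   ≡⟨ cong (∑ t +_) (∑-single k off) ⟩
    ∑ t + (L (inject₁ k) k - 1ℚ) * t k             ≡⟨ cong (λ y → ∑ t + (y - 1ℚ) * t k) (facetNormal-diag a k) ⟩
    ∑ t + (a k - 1ℚ) * t k                         ∎
    where
    open ≡-Reasoning
    open +-*-Solver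
    off : ∀ j → j ≢ k → (L (inject₁ k) j - 1ℚ) * t j ≡ 0ℚ
    off j j≢k = trans (cong (λ y → (y - 1ℚ) * t j) (facetNormal-off a λ k≡j →
        j≢k (sym (Fin.toℕ-injective (trans (sym (Fin.toℕ-inject₁ k)) k≡j)))))
      (*-zeroˡ (t j))

  dot-L-last : ∀ t → dot (L (fromℕ d)) t ≡ ∑ t
  dot-L-last t = ∑-cong λ j → trans (cong (_* t j) (facetNormal-last a j)) (*-identityˡ (t j))

  dot-v-init : ∀ b i → dot b (v (inject₁ i)) ≡ b i
  dot-v-init b i = trans (∑-cong λ j → cong (b j *_) (simplexVertex-init q i j)) (dot-basis b i)

  dot-v-last : ∀ b → dot b (v (fromℕ d)) ≡ - dot b q
  dot-v-last b = trans (∑-cong λ j → cong (b j *_) (simplexVertex-last q j)) (dot-neg b q)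

  dot-L-init-q : ∀ k → dot (L (inject₁ k)) q ≡ - 1ℚ
  dot-L-init-q k = begin
    dot (L (inject₁ k)) q        ≡⟨ dot-L-init k q ⟩
    ∑ q + (a k - 1ℚ) * q k       ≡⟨ cong (∑ q +_) (solve 2 (λ a y → (a :- con 1ℚ) :* y := :- (y :* (con 1ℚ :- a))) refl (a k) (q k)) ⟩
    ∑ q + - (q k * (1ℚ - a k))   ≡⟨ cong (λ y → ∑ q + - y) (facet k) ⟩
    ∑ q + - (1ℚ + ∑ q)           ≡⟨ solve 1 (λ s → s :+ :- (con 1ℚ :+ s) := :- con 1ℚ) refl (∑ q) ⟩
    - 1ℚ                         ∎
    where
    open ≡-Reasoning
    open +-*-Solver

  incident : ∀ j i → j ≢ i → dot (L j) (v i) ≡ 1ℚ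
  incident j i j≢i with initLast j | initLast i
  ... | init j′ | init i′ = trans (dot-v-init (L j) i′) (facetNormal-off a λ j′≡i′ →
    j≢i (cong inject₁ (Fin.toℕ-injective (trans (sym (Fin.toℕ-inject₁ j′)) j′≡i′))))
  ... | init j′ | last    = trans (dot-v-last (L j)) (cong -_ (dot-L-init-q j′))
  ... | last    | init i′ = trans (dot-v-init (L j) i′) (facetNormal-last a i′)
  ... | last    | last    = contradiction refl j≢i

  diagonal : ∀ i → dot (L i) (v i) < 1ℚ
  diagonal i with initLast i
  ... | init i′ = subst (_< 1ℚ) (sym (trans (dot-v-init (L i) i′) (facetNormal-diag a i′))) (a<1 i′)
  ... | last    = ≤-<-trans (≤-reflexive (trans (dot-v-last (L i)) (cong -_ (dot-L-last q))))
                    (≤-<-trans (neg-antimono-≤ (∑-nonNeg q≥0)) (positive⁻¹ 1ℚ))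

  ρ : Point d → ℚ
  ρ t = (1ℚ - ∑ t) * 1/ P

  barycentric : Point d → Point (suc d)
  barycentric t = snoc (λ i → t i + ρ t * q i) (ρ t)

  barycentric-init : ∀ t i → barycentric t (inject₁ i) ≡ t i + ρ t * q i
  barycentric-init t = snoc-inject₁ (λ i → t i + ρ t * q i) (ρ t)

  barycentric-init-facet : ∀ t i → barycentric t (inject₁ i) ≡ (1ℚ - dot (L (inject₁ i)) t) * q i * 1/ P
  barycentric-init-facet t i = sym (begin
    (1ℚ - dot (L (inject₁ i)) t) * q i * 1/ P            ≡⟨ cong (λ y → (1ℚ - y) * q i * 1/ P) (dot-L-init i t) ⟩
    (1ℚ - (∑ t + (a i - 1ℚ) * t i)) * q i * 1/ P          ≡⟨ solve 5 (λ S A T Q I →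
         (con 1ℚ :- (S :+ (A :- con 1ℚ) :* T)) :* Q :* I := T :* (Q :* (con 1ℚ :- A) :* I) :+ (con 1ℚ :- S) :* I :* Q)
         refl (∑ t) (a i) (t i) (q i) (1/ P) ⟩
    t i * (q i * (1ℚ - a i) * 1/ P) + ρ t * q i          ≡⟨ cong (λ y → t i * (y * 1/ P) + ρ t * q i) (facet i) ⟩
    t i * (P * 1/ P) + ρ t * q i                         ≡⟨ cong (λ y → t i * y + ρ t * q i) (*-inverseʳ P) ⟩
    t i * 1ℚ + ρ t * q i                                 ≡⟨ cong (_+ ρ t * q i) (*-identityʳ (t i)) ⟩
    t i + ρ t * q i                                      ≡⟨ barycentric-init t i ⟨
    barycentric t (inject₁ i)                            ∎)
    where
    open ≡-Reasoning
    open +-*-Solver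

  barycentric-last : ∀ t → barycentric t (fromℕ d) ≡ ρ t
  barycentric-last t = snoc-fromℕ d (λ i → t i + ρ t * q i) (ρ t)

  ∑-barycentric : ∀ t → ∑ (barycentric t) ≡ 1ℚ
  ∑-barycentric t = begin
    ∑ (barycentric t)                                         ≡⟨ ∑-init-last (barycentric t) ⟩
    ∑ (barycentric t ∘ inject₁) + barycentric t (fromℕ d)     ≡⟨ cong₂ _+_ (∑-cong (barycentric-init t)) (barycentric-last t) ⟩
    ∑ (λ i → t i + ρ t * q i) + ρ t                           ≡⟨ cong (_+ ρ t) (∑-+ t (λ i → ρ t * q i)) ⟩
    ∑ t + ∑ (λ i → ρ t * q i) + ρ t                           ≡⟨ cong (λ y → ∑ t + y + ρ t) (∑-*ˡ (ρ t) q) ⟩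
    ∑ t + ρ t * ∑ q + ρ t                                     ≡⟨ solve 3 (λ S R Q → S :+ R :* Q :+ R := S :+ R :* (con 1ℚ :+ Q)) refl (∑ t) (ρ t) (∑ q) ⟩
    ∑ t + ρ t * P                                             ≡⟨ cong (∑ t +_) (*-assoc (1ℚ - ∑ t) (1/ P) P) ⟩
    ∑ t + (1ℚ - ∑ t) * (1/ P * P)                             ≡⟨ cong (λ y → ∑ t + (1ℚ - ∑ t) * y) (*-inverseˡ P) ⟩
    ∑ t + (1ℚ - ∑ t) * 1ℚ                                     ≡⟨ solve 1 (λ S → S :+ (con 1ℚ :- S) :* con 1ℚ := con 1ℚ) refl (∑ t) ⟩
    1ℚ                                                        ∎
    where
    open ≡-Reasoning
    open +-*-Solver

  barycentric-combination : ∀ t c → t c ≡ ∑ (λ k → barycentric t k * v k c)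
  barycentric-combination t c = sym (begin
    ∑ (λ k → barycentric t k * v k c)
      ≡⟨ ∑-init-last (λ k → barycentric t k * v k c) ⟩
    ∑ (λ i → barycentric t (inject₁ i) * v (inject₁ i) c) + barycentric t (fromℕ d) * v (fromℕ d) c
      ≡⟨ cong₂ _+_ (∑-cong λ i → cong₂ _*_ (barycentric-init t i) (simplexVertex-init q i c))
                   (cong₂ _*_ (barycentric-last t) (simplexVertex-last q c)) ⟩
    ∑ (λ i → (t i + ρ t * q i) * basis i c) + ρ t * - q c
      ≡⟨ cong (_+ ρ t * - q c) (∑-single c λ i i≢c → trans (cong ((t i + ρ t * q i) *_) (basis-off i≢c)) (*-zeroʳ (t i + ρ t * q i))) ⟩
    (t c + ρ t * q c) * basis c c + ρ t * - q c
      ≡⟨ cong (λ y → (t c + ρ t * q c) * y + ρ t * - q c) (basis-diag c) ⟩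
    (t c + ρ t * q c) * 1ℚ + ρ t * - q c
      ≡⟨ solve 3 (λ T R Q → (T :+ R :* Q) :* con 1ℚ :+ R :* (:- Q) := T) refl (t c) (ρ t) (q c) ⟩
    t c ∎)
    where
    open ≡-Reasoning
    open +-*-Solver

  barycentric-nonNeg : ∀ t → (∀ k → dot (L k) t ≤ℚ 1ℚ) → ∀ k → 0ℚ ≤ℚ barycentric t k
  barycentric-nonNeg t t≤1 k with initLast k
  ... | init i = subst (0ℚ ≤ℚ_) (sym (barycentric-init-facet t i))
                   (0≤* (0≤* (0≤1-p (t≤1 (inject₁ i))) (q≥0 i)) 0≤1/P)
  ... | last   = subst (0ℚ ≤ℚ_) (sym (barycentric-last t))
                   (0≤* (0≤1-p (subst (_≤ℚ 1ℚ) (dot-L-last t) (t≤1 (fromℕ d)))) 0≤1/P)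

  open FacetIncidence L v incident diagonal

  irredundantHDescription : {{ℕ.NonZero d}} → IsIrredundantHDescription L (λ _ → 1ℚ) (InConvexHull v)
  irredundantHDescription = (λ t → mk⇔ InConvexHull⇒dot≤1 λ t≤1 →
      barycentric t , barycentric-nonNeg t t≤1 , ∑-barycentric t , barycentric-combination t)
    , irredundant other
    where
    other : ∀ k → ∃ λ j → j ≢ k
    other k with initLast k
    ... | init i = fromℕ d , Fin.fromℕ≢inject₁
    ... | last   = inject₁ (fromℕ< (ℕ.>-nonZero⁻¹ d)) , Fin.fromℕ≢inject₁ ∘ sym

IsIrredundantHDescription-congˡ : ∀ {m d} {a a′ : Fin m → Point d} {b : Fin m → ℚ} {P : Point d → Set} →
  (∀ k j → a k j ≡ a′ k j) → IsIrredundantHDescription a b P → IsIrredundantHDescription a′ b P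
IsIrredundantHDescription-congˡ {a = a} {a′} {b} a≗a′ (describes , irredundant) =
  (λ t → mk⇔ (λ t∈P k → subst (_≤ℚ b k) (dot≡ k t) (Equivalence.to (describes t) t∈P k))
             (λ t≤b → Equivalence.from (describes t) λ k → subst (_≤ℚ b k) (sym (dot≡ k t)) (t≤b k)))
  , λ k → let (t , satisfied , violated) = irredundant k in
    t , (λ j j≢k → subst (_≤ℚ b j) (dot≡ j t) (satisfied j j≢k)) , subst (b k <_) (dot≡ k t) violated
  where
  dot≡ : ∀ k t → dot (a k) t ≡ dot (a′ k) t
  dot≡ k t = ∑-cong λ j → cong (_* t j) (a≗a′ k j)

lamDiag : (r₁ x₁ : ℕ) → Point (dim r₁ x₁)
lamDiag r₁ x₁ j = if ⌊ toℕ j ℕ.<? x₁ ⌋ then - ℕtoℚ (x₁ ℕ.* r₁) else - ℕtoℚ (r₁ ∸ 1)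

lamCoeff≡facetNormal : ∀ r₁ x₁ k j → lamCoeff r₁ x₁ k j ≡ facetNormal (lamDiag r₁ x₁) k j
lamCoeff≡facetNormal r₁ x₁ k j with toℕ k ℕ.≟ toℕ j
... | yes k≡j = cong (λ n → if ⌊ n ℕ.<? x₁ ⌋ then - ℕtoℚ (x₁ ℕ.* r₁) else - ℕtoℚ (r₁ ∸ 1)) k≡j
... | no _    = refl

ℕtoℚ-*-suc : ∀ m n → ℕtoℚ m * (1ℚ - - ℕtoℚ n) ≡ ℕtoℚ (m ℕ.* suc n)
ℕtoℚ-*-suc m n = begin
  ℕtoℚ m * (1ℚ - - ℕtoℚ n)   ≡⟨ cong (ℕtoℚ m *_) (solve 1 (λ X → con 1ℚ :- (:- X) := con 1ℚ :+ X) refl (ℕtoℚ n)) ⟩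
  ℕtoℚ m * (1ℚ + ℕtoℚ n)     ≡⟨ cong (ℕtoℚ m *_) (ℕtoℚ-suc n) ⟨
  ℕtoℚ m * ℕtoℚ (suc n)      ≡⟨ ℕtoℚ-* m (suc n) ⟨
  ℕtoℚ (m ℕ.* suc n)         ∎
  where
  open ≡-Reasoning
  open +-*-Solver

module _ (m x : ℕ) where

  dim≡x+m : dim (suc m) x ≡ x ℕ.+ m
  dim≡x+m = ℕₚ.+-∸-assoc x (s≤s z≤n)

  qTotal : ℕ
  qTotal = x ℕ.* suc m ℕ.+ m ℕ.* (1 ℕ.+ suc m ℕ.* x)

  ∑-qvec : ∑ (qvec (suc m) x) ≡ ℕtoℚ qTotal
  ∑-qvec = begin
    ∑ (qvec (suc m) x)
      ≡⟨ subst (λ n → ∑ {n} (λ c → if ⌊ toℕ c ℕ.<? x ⌋ then A else B) ≡ ℕtoℚ x * A + ℕtoℚ m * B)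
               (sym dim≡x+m) (∑-if-< x m) ⟩
    ℕtoℚ x * A + ℕtoℚ m * B
      ≡⟨ cong₂ _+_ (ℕtoℚ-* x (suc m)) (ℕtoℚ-* m (1 ℕ.+ suc m ℕ.* x)) ⟨
    ℕtoℚ (x ℕ.* suc m) + ℕtoℚ (m ℕ.* (1 ℕ.+ suc m ℕ.* x))
      ≡⟨ ℕtoℚ-+ (x ℕ.* suc m) (m ℕ.* (1 ℕ.+ suc m ℕ.* x)) ⟨
    ℕtoℚ qTotal ∎
    where
    open ≡-Reasoning
    A = ℕtoℚ (suc m)
    B = ℕtoℚ (1 ℕ.+ suc m ℕ.* x)

  qvec-nonNeg : ∀ k → 0ℚ ≤ℚ qvec (suc m) x k
  qvec-nonNeg k = by-case ⌊ toℕ k ℕ.<? x ⌋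
    where
    by-case : ∀ b → 0ℚ ≤ℚ (if b then ℕtoℚ (suc m) else ℕtoℚ (1 ℕ.+ suc m ℕ.* x))
    by-case true  = ℕtoℚ-nonNeg (suc m)
    by-case false = ℕtoℚ-nonNeg (1 ℕ.+ suc m ℕ.* x)

  qvec-facet : ∀ k → qvec (suc m) x k * (1ℚ - lamDiag (suc m) x k) ≡ 1ℚ + ∑ (qvec (suc m) x)
  qvec-facet k = begin
    qvec (suc m) x k * (1ℚ - lamDiag (suc m) x k)   ≡⟨ by-case ⌊ toℕ k ℕ.<? x ⌋ ⟩
    ℕtoℚ (suc qTotal)                               ≡⟨ ℕtoℚ-suc qTotal ⟩
    1ℚ + ℕtoℚ qTotal                                ≡⟨ cong (1ℚ +_) ∑-qvec ⟨
    1ℚ + ∑ (qvec (suc m) x)                         ∎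
    where
    open ≡-Reasoning
    first-block : ∀ m′ x′ → suc m′ ℕ.* suc (x′ ℕ.* suc m′) ≡ suc (x′ ℕ.* suc m′ ℕ.+ m′ ℕ.* (1 ℕ.+ suc m′ ℕ.* x′))
    first-block = solve-∀
    last-block : ∀ m′ x′ → (1 ℕ.+ suc m′ ℕ.* x′) ℕ.* suc m′ ≡ suc (x′ ℕ.* suc m′ ℕ.+ m′ ℕ.* (1 ℕ.+ suc m′ ℕ.* x′))
    last-block = solve-∀
    by-case : ∀ b → (if b then ℕtoℚ (suc m) else ℕtoℚ (1 ℕ.+ suc m ℕ.* x))
                      * (1ℚ - (if b then - ℕtoℚ (x ℕ.* suc m) else - ℕtoℚ m)) ≡ ℕtoℚ (suc qTotal)
    by-case true  = trans (ℕtoℚ-*-suc (suc m) (x ℕ.* suc m)) (cong ℕtoℚ (first-block m x))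
    by-case false = trans (ℕtoℚ-*-suc (1 ℕ.+ suc m ℕ.* x) m) (cong ℕtoℚ (last-block m x))

  dim-nonZero : 1 ≤ x → ℕ.NonZero (dim (suc m) x)
  dim-nonZero 1≤x = ℕ.>-nonZero (ℕₚ.≤-trans 1≤x (ℕₚ.≤-trans (ℕₚ.m≤m+n x m) (ℕₚ.≤-reflexive (sym dim≡x+m))))

proposition2p1 : (r₁ x₁ : ℕ) → 2 ≤ r₁ → 1 ≤ x₁ →
    IsIrredundantHDescription (lamCoeff r₁ x₁) (λ _ → 1ℚ) (Δ r₁ x₁)
proposition2p1 (suc m) x _ 1≤x =
  IsIrredundantHDescription-congˡ (λ k j → sym (lamCoeff≡facetNormal (suc m) x k j))
    (Simplex.irredundantHDescription (qvec (suc m) x) (lamDiag (suc m) x) (qvec-nonNeg m x) (qvec-facet m x)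
      {{dim-nonZero m x 1≤x}})
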